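{- Let $H$ be a $4$-uniform $2$-intersecting hypergraph with $\tau(H)=3$. Then, up to isomorphism and ignoring vertices lying in no edge, $H$ is one of exactly two hypergraphs: (i) the hypergraph whose edges are all $4$-element subsets of a $6$-element set; (ii) the complement of the Fano plane, i.e. the hypergraph on $\{1,\dots,7\}$ whose edges are the complements in $\{1,\dots,7\}$ of the seven sets $\{1,2,4\},\{2,3,5\},\{3,4,6\},\{4,5,7\},\{5,6,1\},\{6,7,2\},\{7,1,3\}$. Moreover both of these hypergraphs are $4$-uniform, $2$-intersecting and have covering number $3$, and they are non-isomorphic.
   Context: A hypergraph is $r$-uniform if every edge has exactly $r$ vertices, and $2$-intersecting if any two distinct edges share at least two vertices. The covering number $\tau(H)$ is the minimum size of a set of vertices meeting every edge. Hypergraphs are finite and simple; two hypergraphs are isomorphic if a bijection of vertex sets maps edges onto edges. -}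

module Defs where

open import Data.Nat using (ℕ; _≤_) renaming (_≟_ to _≟ℕ_)
open import Data.Bool using (Bool; true; false; _∧_)
open import Data.Fin using (Fin; zero; suc) renaming (_≟_ to _≟ᶠ_)
open import Data.Fin.Subset using (Subset; ∣_∣; _∩_; ∁; Nonempty; ⁅_⁆; _∪_; ⊥)
open import Data.Vec using (Vec; tabulate; lookup)
open import Data.List using (List; []; _∷_; map; allFin)
open import Data.Bool.ListAction using (or)
open import Data.Product using (Σ; ∃; _×_)
open import Function.Definitions using (Injective)
open import Relation.Binary.PropositionalEquality using (_≡_; _≢_)
open import Relation.Nullary.Decidable using (⌊_⌋; Dec)
open import Data.Vec.Properties using (≡-dec)
import Data.Bool.Properties as BP

-- A finite simple hypergraph: vertex set Fin n, edge set given by its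
-- characteristic function on subsets of the vertex set (so no repeated edges).
record Hypergraph : Set where
  field
    n    : ℕ
    Edge : Subset n → Bool
open Hypergraph public

IsEdge : (H : Hypergraph) → Subset (n H) → Set
IsEdge H e = Edge H e ≡ true

Uniform : ℕ → Hypergraph → Set
Uniform r H = ∀ e → IsEdge H e → ∣ e ∣ ≡ r

TwoIntersecting : Hypergraph → Set
TwoIntersecting H = ∀ e f → IsEdge H e → IsEdge H f → e ≢ f → 2 ≤ ∣ e ∩ f ∣

Cover : (H : Hypergraph) → Subset (n H) → Set
Cover H C = ∀ e → IsEdge H e → Nonempty (C ∩ e)

CoveringNumber : Hypergraph → ℕ → Set
CoveringNumber H k = (∃ λ C → Cover H C × ∣ C ∣ ≡ k) × (∀ C → Cover H C → k ≤ ∣ C ∣)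

image : ∀ {m n} → (Fin m → Fin n) → Subset m → Subset n
image {m} f T = tabulate λ j → or (map (λ i → lookup T i ∧ ⌊ f i ≟ᶠ j ⌋) (allFin m))

-- H ≅ K up to isolated vertices (intended for K without isolated vertices):
-- an injection f from the vertices of K into the vertices of H such that
-- T ↦ image f T is a bijection from the edges of K onto the edges of H.
-- (Injectivity of f makes T ↦ image f T injective.)  When K has no isolated
-- vertices this says exactly: H with its isolated vertices deleted is
-- isomorphic to K.
record IsoIgnoringIsolated (H K : Hypergraph) : Set where
  field
    f   : Fin (n K) → Fin (n H)
    inj : Injective _≡_ _≡_ f
    fwd : ∀ T → IsEdge K T → IsEdge H (image f T)
    bwd : ∀ S → IsEdge H S → ∃ λ T → IsEdge K T × S ≡ image f T

_≟ₛ_ : ∀ {m} (S T : Subset m) → Dec (S ≡ T)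
_≟ₛ_ = ≡-dec BP._≟_

K6-4 : Hypergraph
K6-4 = record { n = 6 ; Edge = λ S → ⌊ ∣ S ∣ ≟ℕ 4 ⌋ }

-- vertices 1..7 are Fin 7 elements 0..6
v : ℕ → Fin 7
v 1 = zero
v 2 = suc zero
v 3 = suc (suc zero)
v 4 = suc (suc (suc zero))
v 5 = suc (suc (suc (suc zero)))
v 6 = suc (suc (suc (suc (suc zero))))
v _ = suc (suc (suc (suc (suc (suc zero)))))

triple : ℕ → ℕ → ℕ → Subset 7
triple a b c = ⁅ v a ⁆ ∪ (⁅ v b ⁆ ∪ ⁅ v c ⁆)

fanoLines : List (Subset 7)
fanoLines = triple 1 2 4 ∷ triple 2 3 5 ∷ triple 3 4 6 ∷ triple 4 5 7
          ∷ triple 5 6 1 ∷ triple 6 7 2 ∷ triple 7 1 3 ∷ []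

FanoComplement : Hypergraph
FanoComplement = record
  { n = 7
  ; Edge = λ S → or (map (λ L → ⌊ S ≟ₛ ∁ L ⌋) fanoLines) }

module Submission where

-- Fix an edge e = {a₁, a₂, a₃, a₄}. As no two vertices cover H, for each splitting {a, b | c, d} of e
-- some edge avoids a and b; it meets e in c, d and has two more vertices u, w, and an edge avoiding c
-- and d must contain a, b, u, w. Comparing any edge with e and these six edges shows that it is one of
-- them or consists of three vertices of e and a hub: a vertex lying in all three pairs {u, w}. If there
-- is a hub z, an edge avoiding a₁ and z yields a second hub z′, and the edges are exactly the 4-subsets
-- of {a₁, a₂, a₃, a₄, z, z′}. Otherwise the three pairs meet pairwise in three distinct vertices, no
-- edge contains three vertices of e, and e together with the six edges is the complement of a Fano plane.

open import Defs hiding (n)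
open import Data.Product using (_×_; _,_)
open import Data.Sum using (_⊎_)
open import Relation.Nullary using (¬_)

open import Data.Nat using (ℕ; suc; _+_; _∸_; _≤_; _<_; z≤n; s≤s; _≤?_) renaming (_≟_ to _≟ℕ_)
open import Data.Nat.Properties using (≤-trans; ≤-reflexive; ≤-antisym; +-suc; m≤n⇒m≤1+n; ≤⇒≯; <⇒≱; n<1+n)
open import Data.Bool using (true; T; _∧_) renaming (_≟_ to _≟ᵇ_)
open import Data.Bool.Properties using (T-≡; T-∧)
open import Data.Fin using (Fin; #_) renaming (_≟_ to _≟ᶠ_)
import Data.Fin.Properties as Fin
open import Data.Fin.Subset using (Subset; inside; outside; _∈_; _∉_; _⊆_; _∩_; _∪_; ∁; ⁅_⁆; ∣_∣; Nonempty)
  renaming (⊥ to ∅)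
open import Data.Fin.Subset.Properties
  using (_∈?_; nonempty?; anySubset?; ⊆-antisym; drop-∷-⊆; p⊆q⇒∣p∣≤∣q∣; p⊂q⇒∣p∣<∣q∣; ∣⊥∣≡0; ∣⁅x⁆∣≡1; ∣∁p∣≡n∸∣p∣;
         x∈⁅x⁆; x∈⁅y⁆⇒x≡y; ∉⊥; x∈p∪q⁺; x∈p∪q⁻; q⊆p∪q; x∈p∩q⁺; x∈p∩q⁻; x∉p⇒x∈∁p)
open import Data.List using (List; []; _∷_; length; map; allFin)
open import Data.List.Membership.Propositional using () renaming (_∈_ to _∈ₗ_; _∉_ to _∉ₗ_)
open import Data.List.Membership.Propositional.Properties using (∈-allFin; ∈-map⁺; ∈-map⁻)
open import Data.List.Relation.Unary.Any as Any using (Any)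
open import Data.List.Relation.Unary.Any.Properties using (any⁺; any⁻)
open import Data.List.Relation.Unary.All as All using (All; []; _∷_)
open import Data.List.Relation.Unary.All.Properties using (All¬⇒¬Any)
open import Data.List.Relation.Unary.Unique.Propositional using (Unique; []; _∷_)
open import Data.Vec using (Vec; []; _∷_; lookup; here)
open import Data.Vec.Properties using (lookup∘tabulate; []=⇒lookup; lookup⇒[]=)
open import Data.Vec.Relation.Unary.All using ([]; _∷_)
open import Data.Vec.Relation.Unary.Unique.Propositional as Vec using ([]; _∷_)
open import Data.Vec.Relation.Unary.Unique.Propositional.Properties using (lookup-injective)
open import Data.Product using (∃; ∃₂; proj₁; proj₂)
open import Data.Sum using (inj₁; inj₂)
open import Data.Empty using (⊥; ⊥-elim)
open import Data.Unit using (tt)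
open import Function using (_∘_; Injective)
open import Function.Bundles using (Equivalence)
open import Relation.Binary.PropositionalEquality
open import Relation.Nullary using (Dec; yes; no; contradiction)
open import Relation.Nullary.Decidable
  using (⌊_⌋; toWitness; fromWitness; ¬?; _×-dec_; _⊎-dec_; _→-dec_; decidable-stable)

private variable
  k m : ℕ
  x y : Fin m
  S : Subset m
  L : List (Fin m)

-- Counting elements of subsets of Fin m

∣p∪q∣≤∣p∣+∣q∣ : (p q : Subset m) → ∣ p ∪ q ∣ ≤ ∣ p ∣ + ∣ q ∣
∣p∪q∣≤∣p∣+∣q∣ []            []            = z≤n
∣p∪q∣≤∣p∣+∣q∣ (outside ∷ p) (outside ∷ q) = ∣p∪q∣≤∣p∣+∣q∣ p q
∣p∪q∣≤∣p∣+∣q∣ (outside ∷ p) (inside ∷ q)  = ≤-trans (s≤s (∣p∪q∣≤∣p∣+∣q∣ p q)) (≤-reflexive (sym (+-suc _ _)))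
∣p∪q∣≤∣p∣+∣q∣ (inside ∷ p)  (outside ∷ q) = s≤s (∣p∪q∣≤∣p∣+∣q∣ p q)
∣p∪q∣≤∣p∣+∣q∣ (inside ∷ p)  (inside ∷ q)  =
  s≤s (≤-trans (m≤n⇒m≤1+n (∣p∪q∣≤∣p∣+∣q∣ p q)) (≤-reflexive (sym (+-suc _ _))))

p⊆q∧∣q∣≤∣p∣⇒p≡q : {p q : Subset m} → p ⊆ q → ∣ q ∣ ≤ ∣ p ∣ → p ≡ q
p⊆q∧∣q∣≤∣p∣⇒p≡q {p = []}          {[]}          _   _  = refl
p⊆q∧∣q∣≤∣p∣⇒p≡q {p = outside ∷ p} {outside ∷ q} p⊆q le =
  cong (outside ∷_) (p⊆q∧∣q∣≤∣p∣⇒p≡q (drop-∷-⊆ p⊆q) le)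
p⊆q∧∣q∣≤∣p∣⇒p≡q {p = outside ∷ p} {inside ∷ q}  p⊆q le =
  contradiction le (≤⇒≯ (p⊆q⇒∣p∣≤∣q∣ (drop-∷-⊆ p⊆q)))
p⊆q∧∣q∣≤∣p∣⇒p≡q {p = inside ∷ p}  {outside ∷ q} p⊆q le with p⊆q here
... | ()
p⊆q∧∣q∣≤∣p∣⇒p≡q {p = inside ∷ p}  {inside ∷ q}  p⊆q (s≤s le) =
  cong (inside ∷_) (p⊆q∧∣q∣≤∣p∣⇒p≡q (drop-∷-⊆ p⊆q) le)

fromList : List (Fin m) → Subset m
fromList []      = ∅
fromList (x ∷ L) = ⁅ x ⁆ ∪ fromList L

∈fromList⁺ : (L : List (Fin m)) → x ∈ₗ L → x ∈ fromList L
∈fromList⁺ (y ∷ L) (Any.here refl) = x∈p∪q⁺ (inj₁ (x∈⁅x⁆ y))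
∈fromList⁺ (y ∷ L) (Any.there x∈L) = x∈p∪q⁺ (inj₂ (∈fromList⁺ L x∈L))

∈fromList⁻ : (L : List (Fin m)) → x ∈ fromList L → x ∈ₗ L
∈fromList⁻ []      x∈∅ = ⊥-elim (∉⊥ x∈∅)
∈fromList⁻ (y ∷ L) x∈  with x∈p∪q⁻ ⁅ y ⁆ (fromList L) x∈
... | inj₁ x∈⁅y⁆ = Any.here (x∈⁅y⁆⇒x≡y y x∈⁅y⁆)
... | inj₂ x∈L   = Any.there (∈fromList⁻ L x∈L)

∣fromList∣≤length : (L : List (Fin m)) → ∣ fromList L ∣ ≤ length L
∣fromList∣≤length {m} []      = ≤-reflexive (∣⊥∣≡0 m)
∣fromList∣≤length     (x ∷ L) = begin
  ∣ ⁅ x ⁆ ∪ fromList L ∣        ≤⟨ ∣p∪q∣≤∣p∣+∣q∣ ⁅ x ⁆ (fromList L) ⟩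
  ∣ ⁅ x ⁆ ∣ + ∣ fromList L ∣    ≡⟨ cong (_+ ∣ fromList L ∣) (∣⁅x⁆∣≡1 x) ⟩
  suc ∣ fromList L ∣            ≤⟨ s≤s (∣fromList∣≤length L) ⟩
  suc (length L)                ∎
  where open Data.Nat.Properties.≤-Reasoning

length≤∣fromList∣ : Unique L → length L ≤ ∣ fromList L ∣
length≤∣fromList∣ {L = []}    []              = z≤n
length≤∣fromList∣ {L = x ∷ L} (x∉L ∷ unique) = ≤-trans (s≤s (length≤∣fromList∣ unique))
  (p⊂q⇒∣p∣<∣q∣ (q⊆p∪q ⁅ x ⁆ (fromList L) , x , x∈p∪q⁺ (inj₁ (x∈⁅x⁆ x)) ,
                 λ x∈L → All¬⇒¬Any x∉L (∈fromList⁻ L x∈L)))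

∣p∣≤length : (S : Subset m) (L : List (Fin m)) → (∀ {x} → x ∈ S → x ∈ₗ L) → ∣ S ∣ ≤ length L
∣p∣≤length S L S⊆L = ≤-trans (p⊆q⇒∣p∣≤∣q∣ (∈fromList⁺ L ∘ S⊆L)) (∣fromList∣≤length L)

length<∣p∣⇒∃∉ : (S : Subset m) (L : List (Fin m)) → length L < ∣ S ∣ → ∃ λ x → x ∈ S × x ∉ₗ L
length<∣p∣⇒∃∉ S L lt with Fin.any? (λ x → x ∈? S ×-dec ¬? (Any.any? (x ≟ᶠ_) L))
... | yes witness = witness
... | no none     = contradiction (∣p∣≤length S L S⊆L) (<⇒≱ lt)
  where
  S⊆L : ∀ {x} → x ∈ S → x ∈ₗ L
  S⊆L {x} x∈S with Any.any? (x ≟ᶠ_) L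
  ... | yes x∈L = x∈L
  ... | no  x∉L = contradiction (x , x∈S , x∉L) none

∣p∣≤length⇒p≡fromList : Unique L → All (_∈ S) L → ∣ S ∣ ≤ length L → S ≡ fromList L
∣p∣≤length⇒p≡fromList {L = L} unique L⊆S ∣S∣≤ = sym (p⊆q∧∣q∣≤∣p∣⇒p≡q
  (λ x∈L → All.lookup L⊆S (∈fromList⁻ L x∈L))
  (≤-trans ∣S∣≤ (length≤∣fromList∣ unique)))

∣fromList∣≡length : Unique L → ∣ fromList L ∣ ≡ length L
∣fromList∣≡length {L = L} unique = ≤-antisym (∣fromList∣≤length L) (length≤∣fromList∣ unique)

≢head : ∀ {x y : Fin m} {L} → y ∉ₗ x ∷ L → x ≢ y
≢head y∉ x≡y = y∉ (Any.here (sym x≡y))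

∈∉⇒≢ : x ∈ S → y ∉ S → x ≢ y
∈∉⇒≢ x∈S y∉S refl = y∉S x∈S

2≤∣p∩q∣⇒∃₂ : (S T : Subset m) → 2 ≤ ∣ S ∩ T ∣ →
             ∃₂ λ x y → x ≢ y × x ∈ S × x ∈ T × y ∈ S × y ∈ T
2≤∣p∩q∣⇒∃₂ S T 2≤ =
  let (x , x∈ , _)  = length<∣p∣⇒∃∉ (S ∩ T) [] (≤-trans (s≤s z≤n) 2≤)
      (y , y∈ , y∉) = length<∣p∣⇒∃∉ (S ∩ T) (x ∷ []) 2≤
      (x∈S , x∈T)   = x∈p∩q⁻ S T x∈
      (y∈S , y∈T)   = x∈p∩q⁻ S T y∈
  in x , y , ≢head y∉ , x∈S , x∈T , y∈S , y∈T

∣p∣≡2⇒pair : ∣ S ∣ ≡ 2 → ∃₂ λ i j → S ≡ fromList (i ∷ j ∷ [])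
∣p∣≡2⇒pair {S = S} ∣S∣≡2 =
  let (i , i∈ , _)  = length<∣p∣⇒∃∉ S [] (≤-trans (s≤s z≤n) (≤-reflexive (sym ∣S∣≡2)))
      (j , j∈ , j∉) = length<∣p∣⇒∃∉ S (i ∷ []) (≤-reflexive (sym ∣S∣≡2))
  in i , j , ∣p∣≤length⇒p≡fromList ((≢head j∉ ∷ []) ∷ [] ∷ []) (i∈ ∷ j∈ ∷ []) (≤-reflexive ∣S∣≡2)

_∈ᵖ_ : {A : Set} → A → A × A → Set
y ∈ᵖ (u , w) = y ≡ u ⊎ y ≡ w

∈ᵖ-sub : {A : Set} {y p p′ u w : A} → y ∈ᵖ (p , p′) → p ∈ᵖ (u , w) → p′ ∈ᵖ (u , w) → y ∈ᵖ (u , w)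
∈ᵖ-sub (inj₁ refl) p∈ _  = p∈
∈ᵖ-sub (inj₂ refl) _  p′∈ = p′∈

-- Four-element sets

record Quad (S : Subset m) (a b c d : Fin m) : Set where
  field
    card : ∣ S ∣ ≡ 4
    ∈₁ : a ∈ S
    ∈₂ : b ∈ S
    ∈₃ : c ∈ S
    ∈₄ : d ∈ S
    ≢₁₂ : a ≢ b
    ≢₁₃ : a ≢ c
    ≢₁₄ : a ≢ d
    ≢₂₃ : b ≢ c
    ≢₂₄ : b ≢ d
    ≢₃₄ : c ≢ d
open Quad public

module _ {S : Subset m} {a b c d : Fin m} (q : Quad S a b c d) where

  Quad-unique : Unique (a ∷ b ∷ c ∷ d ∷ [])
  Quad-unique = (≢₁₂ q ∷ ≢₁₃ q ∷ ≢₁₄ q ∷ []) ∷ (≢₂₃ q ∷ ≢₂₄ q ∷ []) ∷ (≢₃₄ q ∷ []) ∷ [] ∷ []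

  Quad⇒≡fromList : S ≡ fromList (a ∷ b ∷ c ∷ d ∷ [])
  Quad⇒≡fromList = ∣p∣≤length⇒p≡fromList Quad-unique (∈₁ q ∷ ∈₂ q ∷ ∈₃ q ∷ ∈₄ q ∷ []) (≤-reflexive (card q))

  Quad-cases : ∀ {x} → x ∈ S → x ≡ a ⊎ x ≡ b ⊎ x ≡ c ⊎ x ≡ d
  Quad-cases {x} x∈S with ∈fromList⁻ (a ∷ b ∷ c ∷ d ∷ []) (subst (x ∈_) Quad⇒≡fromList x∈S)
  ... | Any.here x≡a                                 = inj₁ x≡a
  ... | Any.there (Any.here x≡b)                     = inj₂ (inj₁ x≡b)
  ... | Any.there (Any.there (Any.here x≡c))         = inj₂ (inj₂ (inj₁ x≡c))
  ... | Any.there (Any.there (Any.there (Any.here x≡d))) = inj₂ (inj₂ (inj₂ x≡d))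

  Quad-move : ∀ {G} → ∣ G ∣ ≡ 4 → a ∈ G → b ∈ G → c ∈ G → d ∈ G → Quad G a b c d
  Quad-move ∣G∣≡4 a∈ b∈ c∈ d∈ = record
    { card = ∣G∣≡4 ; ∈₁ = a∈ ; ∈₂ = b∈ ; ∈₃ = c∈ ; ∈₄ = d∈
    ; ≢₁₂ = ≢₁₂ q ; ≢₁₃ = ≢₁₃ q ; ≢₁₄ = ≢₁₄ q ; ≢₂₃ = ≢₂₃ q ; ≢₂₄ = ≢₂₄ q ; ≢₃₄ = ≢₃₄ q }

  ∉Quad : x ≢ a → x ≢ b → x ≢ c → x ≢ d → x ∉ S
  ∉Quad x≢a x≢b x≢c x≢d x∈S with Quad-cases x∈S
  ... | inj₁ x≡a               = x≢a x≡a
  ... | inj₂ (inj₁ x≡b)        = x≢b x≡b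
  ... | inj₂ (inj₂ (inj₁ x≡c)) = x≢c x≡c
  ... | inj₂ (inj₂ (inj₂ x≡d)) = x≢d x≡d

  ∈ᵖ⇒∈ : y ∈ᵖ (c , d) → y ∈ S
  ∈ᵖ⇒∈ (inj₁ refl) = ∈₃ q
  ∈ᵖ⇒∈ (inj₂ refl) = ∈₄ q

module _ {S : Subset m} (∣S∣≡4 : ∣ S ∣ ≡ 4) where

  completeQuad : ∀ {a b c} → a ∈ S → b ∈ S → c ∈ S → a ≢ b → a ≢ c → b ≢ c → ∃ λ d → Quad S a b c d
  completeQuad {a} {b} {c} a∈ b∈ c∈ a≢b a≢c b≢c =
    let (d , d∈ , d∉) = length<∣p∣⇒∃∉ S (a ∷ b ∷ c ∷ []) (≤-reflexive (sym ∣S∣≡4))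
    in d , record
    { card = ∣S∣≡4 ; ∈₁ = a∈ ; ∈₂ = b∈ ; ∈₃ = c∈ ; ∈₄ = d∈
    ; ≢₁₂ = a≢b ; ≢₁₃ = a≢c ; ≢₁₄ = ≢head d∉ ; ≢₂₃ = b≢c
    ; ≢₂₄ = ≢head (d∉ ∘ Any.there) ; ≢₃₄ = ≢head (d∉ ∘ Any.there ∘ Any.there) }

  completeQuad₂ : ∀ {a b} → a ∈ S → b ∈ S → a ≢ b → ∃₂ λ c d → Quad S a b c d
  completeQuad₂ {a} {b} a∈ b∈ a≢b =
    let (c , c∈ , c∉) = length<∣p∣⇒∃∉ S (a ∷ b ∷ []) (≤-trans (s≤s (s≤s (s≤s z≤n))) (≤-reflexive (sym ∣S∣≡4)))
    in c , completeQuad a∈ b∈ c∈ a≢b (≢head c∉) (≢head (c∉ ∘ Any.there))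

  ∣p∣≡4⇒Quad : ∃ λ a → ∃ λ b → ∃ λ c → ∃ λ d → Quad S a b c d
  ∣p∣≡4⇒Quad =
    let (a , a∈ , _)  = length<∣p∣⇒∃∉ S [] (≤-trans (s≤s z≤n) (≤-reflexive (sym ∣S∣≡4)))
        (b , b∈ , b∉) = length<∣p∣⇒∃∉ S (a ∷ []) (≤-trans (s≤s (s≤s z≤n)) (≤-reflexive (sym ∣S∣≡4)))
    in a , b , completeQuad₂ a∈ b∈ (≢head b∉)

swap₁₂ : ∀ {S : Subset m} {a b c d} → Quad S a b c d → Quad S b a c d
swap₁₂ q = record { card = card q ; ∈₁ = ∈₂ q ; ∈₂ = ∈₁ q ; ∈₃ = ∈₃ q ; ∈₄ = ∈₄ q
                  ; ≢₁₂ = ≢₁₂ q ∘ sym ; ≢₁₃ = ≢₂₃ q ; ≢₁₄ = ≢₂₄ q ; ≢₂₃ = ≢₁₃ q ; ≢₂₄ = ≢₁₄ q ; ≢₃₄ = ≢₃₄ q }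

swap₂₃ : ∀ {S : Subset m} {a b c d} → Quad S a b c d → Quad S a c b d
swap₂₃ q = record { card = card q ; ∈₁ = ∈₁ q ; ∈₂ = ∈₃ q ; ∈₃ = ∈₂ q ; ∈₄ = ∈₄ q
                  ; ≢₁₂ = ≢₁₃ q ; ≢₁₃ = ≢₁₂ q ; ≢₁₄ = ≢₁₄ q ; ≢₂₃ = ≢₂₃ q ∘ sym ; ≢₂₄ = ≢₃₄ q ; ≢₃₄ = ≢₂₄ q }

swap₃₄ : ∀ {S : Subset m} {a b c d} → Quad S a b c d → Quad S a b d c
swap₃₄ q = record { card = card q ; ∈₁ = ∈₁ q ; ∈₂ = ∈₂ q ; ∈₃ = ∈₄ q ; ∈₄ = ∈₃ q
                  ; ≢₁₂ = ≢₁₂ q ; ≢₁₃ = ≢₁₄ q ; ≢₁₄ = ≢₁₃ q ; ≢₂₃ = ≢₂₄ q ; ≢₂₄ = ≢₂₃ q ; ≢₃₄ = ≢₃₄ q ∘ sym }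

swapPairs : ∀ {S : Subset m} {a b c d} → Quad S a b c d → Quad S c d a b
swapPairs = swap₂₃ ∘ swap₁₂ ∘ swap₃₄ ∘ swap₂₃

∈image⁻ : (f : Fin k → Fin m) (T : Subset k) → y ∈ image f T → ∃ λ x → x ∈ T × f x ≡ y
∈image⁻ {k} {y = y} f T y∈ with Any.satisfied (any⁻ _ (allFin k)
  (Equivalence.from T-≡ (trans (sym (lookup∘tabulate _ y)) ([]=⇒lookup y∈))))
... | x , found with Equivalence.to T-∧ found
... | x∈T , fx≡y = x , lookup⇒[]= x T (Equivalence.to T-≡ x∈T) , toWitness fx≡y

∈image⁺ : (f : Fin k → Fin m) (X : Subset k) → x ∈ X → f x ∈ image f X
∈image⁺ {k} {x = x} f X x∈X = lookup⇒[]= (f x) (image f X)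
  (trans (lookup∘tabulate _ (f x)) (Equivalence.to T-≡ (any⁺ _ (Any.map (λ { refl → found }) (∈-allFin x)))))
  where
  found : T (lookup X x ∧ ⌊ f x ≟ᶠ f x ⌋)
  found = Equivalence.from T-∧ (Equivalence.from T-≡ ([]=⇒lookup x∈X) , fromWitness refl)

image-fromList : (f : Fin k → Fin m) (L : List (Fin k)) → image f (fromList L) ≡ fromList (map f L)
image-fromList f L = ⊆-antisym ⊆map ⊇map
  where
  ⊆map : image f (fromList L) ⊆ fromList (map f L)
  ⊆map y∈ with ∈image⁻ f (fromList L) y∈
  ... | x , x∈ , refl = ∈fromList⁺ (map f L) (∈-map⁺ f (∈fromList⁻ L x∈))
  ⊇map : fromList (map f L) ⊆ image f (fromList L)
  ⊇map y∈ with ∈-map⁻ f (∈fromList⁻ (map f L) y∈)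
  ... | x , x∈L , refl = ∈image⁺ f (fromList L) (∈fromList⁺ L x∈L)

module _ (f : Fin k → Fin m) (i₁ i₂ i₃ i₄ : Fin k) {S : Subset m} (q : Quad S (f i₁) (f i₂) (f i₃) (f i₄)) where

  Quad⇒≡image : S ≡ image f (fromList (i₁ ∷ i₂ ∷ i₃ ∷ i₄ ∷ []))
  Quad⇒≡image = trans (Quad⇒≡fromList q) (sym (image-fromList f (i₁ ∷ i₂ ∷ i₃ ∷ i₄ ∷ [])))

  Quad⇒∣preimage∣≡4 : ∣ fromList (i₁ ∷ i₂ ∷ i₃ ∷ i₄ ∷ []) ∣ ≡ 4
  Quad⇒∣preimage∣≡4 = ∣fromList∣≡length
    ((≢₁₂ q ∘ cong f ∷ ≢₁₃ q ∘ cong f ∷ ≢₁₄ q ∘ cong f ∷ []) ∷ (≢₂₃ q ∘ cong f ∷ ≢₂₄ q ∘ cong f ∷ []) ∷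
     (≢₃₄ q ∘ cong f ∷ []) ∷ [] ∷ [])

∣image∣≤4 : (f : Fin k → Fin m) (T : Subset k) → ∣ T ∣ ≡ 4 → ∣ image f T ∣ ≤ 4
∣image∣≤4 f T ∣T∣≡4 =
  let (i₁ , i₂ , i₃ , i₄ , q) = ∣p∣≡4⇒Quad {S = T} ∣T∣≡4
      L = i₁ ∷ i₂ ∷ i₃ ∷ i₄ ∷ []
  in ≤-trans (≤-reflexive (cong ∣_∣ (trans (cong (image f) (Quad⇒≡fromList q)) (image-fromList f L))))
             (∣fromList∣≤length (map f L))

⌊⌋≡true⇒ : ∀ {A : Set} (a? : Dec A) → ⌊ a? ⌋ ≡ true → A
⌊⌋≡true⇒ a? p = toWitness (Equivalence.from T-≡ p)

⌊⌋≡true⇐ : ∀ {A : Set} (a? : Dec A) → A → ⌊ a? ⌋ ≡ true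
⌊⌋≡true⇐ a? a = Equivalence.to T-≡ (fromWitness a)

fano-edge⁻ : ∀ {T} → IsEdge FanoComplement T → Any (λ L → T ≡ ∁ L) fanoLines
fano-edge⁻ {T} T-edge = Any.map toWitness (any⁻ (λ L → ⌊ T ≟ₛ ∁ L ⌋) fanoLines (Equivalence.from T-≡ T-edge))

fano-edge⁺ : ∀ {T} → Any (λ L → T ≡ ∁ L) fanoLines → IsEdge FanoComplement T
fano-edge⁺ {T} T≡∁L = Equivalence.to T-≡ (any⁺ (λ L → ⌊ T ≟ₛ ∁ L ⌋) (Any.map fromWitness T≡∁L))

fano-all : ∀ {P : Subset 7 → Set} → All (P ∘ ∁) fanoLines → ∀ T → IsEdge FanoComplement T → P T
fano-all {P} P∁ T T-edge = let (P∁L , T≡∁L) = All.lookupAny P∁ (fano-edge⁻ {T} T-edge) in subst P (sym T≡∁L) P∁L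

-- Classification

module Classification (H : Hypergraph) (uniform : Uniform 4 H) (intersecting : TwoIntersecting H)
                      (noSmallCover : ∀ C → Cover H C → 3 ≤ ∣ C ∣) where

  V : Set
  V = Fin (Hypergraph.n H)

  private variable
    a b c d p u w z : V
    E F G : Subset (Hypergraph.n H)

  someEdge : ∃ (IsEdge H)
  someEdge with anySubset? (λ G → Edge H G ≟ᵇ true)
  ... | yes found = found
  ... | no  none  = contradiction (subst (3 ≤_) (∣⊥∣≡0 (Hypergraph.n H)) (noSmallCover ∅ ∅-covers)) λ ()
    where
    ∅-covers : Cover H ∅
    ∅-covers G G-edge = contradiction (G , G-edge) none

  edgeAvoiding : (x y : V) → ∃ λ G → IsEdge H G × x ∉ G × y ∉ G
  edgeAvoiding x y with anySubset? (λ G → (Edge H G ≟ᵇ true) ×-dec (¬? (x ∈? G) ×-dec ¬? (y ∈? G)))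
  ... | yes found = found
  ... | no  none  = contradiction (noSmallCover C C-covers) (<⇒≱ (s≤s (∣fromList∣≤length (x ∷ y ∷ []))))
    where
    C = fromList (x ∷ y ∷ [])
    C-covers : Cover H C
    C-covers G G-edge with x ∈? G | y ∈? G
    ... | yes x∈G | _       = x , x∈p∩q⁺ (∈fromList⁺ (x ∷ y ∷ []) (Any.here refl) , x∈G)
    ... | no  _   | yes y∈G = y , x∈p∩q⁺ (∈fromList⁺ (x ∷ y ∷ []) (Any.there (Any.here refl)) , y∈G)
    ... | no  x∉G | no  y∉G = contradiction (G , G-edge , x∉G , y∉G) none

  -- E ≢ F since z separates them, and of their two common vertices at most one is p.
  sharedBesides : ∀ {P : V → Set} → IsEdge H E → IsEdge H F → z ∈ E → z ∉ F →
                  (∀ {x} → x ∈ E → x ∈ F → x ≡ p ⊎ P x) → ∃ λ x → x ∈ E × x ∈ F × P x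
  sharedBesides {E = E} {F = F} E-edge F-edge z∈E z∉F cases
    with 2≤∣p∩q∣⇒∃₂ E F (intersecting E F E-edge F-edge (λ { refl → z∉F z∈E }))
  ... | x , y , x≢y , x∈E , x∈F , y∈E , y∈F with cases x∈E x∈F | cases y∈E y∈F
  ... | inj₂ Px   | _         = x , x∈E , x∈F , Px
  ... | inj₁ _    | inj₂ Py   = y , y∈E , y∈F , Py
  ... | inj₁ refl | inj₁ refl = contradiction refl x≢y

  avoids₁₂⇒∋₃ : IsEdge H E → Quad E a b c d → IsEdge H F → a ∉ F → b ∉ F → c ∈ F
  avoids₁₂⇒∋₃ {E = E} {a} {b} {c} {d} {F} E-edge q F-edge a∉F b∉F =
    let (_ , _ , x∈F , x≡c) = sharedBesides {p = d} {P = _≡ c} E-edge F-edge (∈₁ q) a∉F cases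
    in subst (_∈ F) x≡c x∈F
    where
    cases : ∀ {x} → x ∈ E → x ∈ F → x ≡ d ⊎ x ≡ c
    cases x∈E x∈F with Quad-cases q x∈E
    ... | inj₁ refl              = contradiction x∈F a∉F
    ... | inj₂ (inj₁ refl)       = contradiction x∈F b∉F
    ... | inj₂ (inj₂ (inj₁ x≡c)) = inj₂ x≡c
    ... | inj₂ (inj₂ (inj₂ x≡d)) = inj₁ x≡d

  avoids₁₂⇒∋₃₄ : IsEdge H E → Quad E a b c d → IsEdge H F → a ∉ F → b ∉ F → c ∈ F × d ∈ F
  avoids₁₂⇒∋₃₄ E-edge q F-edge a∉F b∉F =
    avoids₁₂⇒∋₃ E-edge q F-edge a∉F b∉F , avoids₁₂⇒∋₃ E-edge (swap₃₄ q) F-edge a∉F b∉F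

  ¬avoids₂₃₄ : IsEdge H E → Quad E a b c d → IsEdge H F → b ∉ F → c ∉ F → d ∉ F → ⊥
  ¬avoids₂₃₄ {E = E} {a} {F = F} E-edge q F-edge b∉F c∉F d∉F =
    proj₂ (proj₂ (proj₂ (sharedBesides {p = a} {P = λ _ → ⊥} E-edge F-edge (∈₂ q) b∉F cases)))
    where
    cases : ∀ {x} → x ∈ E → x ∈ F → x ≡ a ⊎ ⊥
    cases x∈E x∈F with Quad-cases q x∈E
    ... | inj₁ x≡a                = inj₁ x≡a
    ... | inj₂ (inj₁ refl)        = contradiction x∈F b∉F
    ... | inj₂ (inj₂ (inj₁ refl)) = contradiction x∈F c∉F
    ... | inj₂ (inj₂ (inj₂ refl)) = contradiction x∈F d∉F

  record Split (a b c d u w : V) : Set where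
    field
      {left right} : Subset (Hypergraph.n H)
      left-edge    : IsEdge H left
      right-edge   : IsEdge H right
      left-quad    : Quad left a b u w
      right-quad   : Quad right c d u w
  open Split

  -- u, w are the vertices besides c, d of an edge avoiding a, b; an edge avoiding c, d contains a, b, u, w.
  split : IsEdge H E → Quad E a b c d → ∃₂ λ u w → Split a b c d u w
  split {a = a} {b} {c} {d} E-edge q =
    let (F , F-edge , a∉F , b∉F) = edgeAvoiding a b
        (c∈F , d∈F)              = avoids₁₂⇒∋₃₄ E-edge q F-edge a∉F b∉F
        (u , w , qF)             = completeQuad₂ (uniform _ F-edge) c∈F d∈F (≢₃₄ q)
        (F′ , F′-edge , c∉F′ , d∉F′) = edgeAvoiding c d
        (a∈F′ , b∈F′)            = avoids₁₂⇒∋₃₄ E-edge (swapPairs q) F′-edge c∉F′ d∉F′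
        (u∈F′ , w∈F′)            = avoids₁₂⇒∋₃₄ F-edge qF F′-edge c∉F′ d∉F′
    in u , w , record
      { left-edge = F′-edge ; right-edge = F-edge ; right-quad = qF
      ; left-quad = record
        { card = uniform _ F′-edge ; ∈₁ = a∈F′ ; ∈₂ = b∈F′ ; ∈₃ = u∈F′ ; ∈₄ = w∈F′
        ; ≢₁₂ = ≢₁₂ q ; ≢₁₃ = ∈∉⇒≢ (∈₃ qF) a∉F ∘ sym ; ≢₁₄ = ∈∉⇒≢ (∈₄ qF) a∉F ∘ sym
        ; ≢₂₃ = ∈∉⇒≢ (∈₃ qF) b∉F ∘ sym ; ≢₂₄ = ∈∉⇒≢ (∈₄ qF) b∉F ∘ sym ; ≢₃₄ = ≢₃₄ qF } }

  Split-flip : Split a b c d u w → Split c d a b u w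
  Split-flip S = record { left-edge = right-edge S ; right-edge = left-edge S
                        ; left-quad = right-quad S ; right-quad = left-quad S }

  Split-swapˡ : Split a b c d u w → Split b a c d u w
  Split-swapˡ S = record { left-edge = left-edge S ; right-edge = right-edge S
                         ; left-quad = swap₁₂ (left-quad S) ; right-quad = right-quad S }

  Split-swapʳ : Split a b c d u w → Split a b d c u w
  Split-swapʳ S = record { left-edge = left-edge S ; right-edge = right-edge S
                         ; left-quad = left-quad S ; right-quad = swap₁₂ (right-quad S) }

  Split-choose : ∀ {y y′} → Split a b c d u w → y ∈ᵖ (u , w) → y′ ∈ᵖ (u , w) → y ≢ y′ → Split a b c d y y′
  Split-choose S (inj₁ refl) (inj₁ refl) y≢y′ = contradiction refl y≢y′
  Split-choose S (inj₁ refl) (inj₂ refl) _    = S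
  Split-choose S (inj₂ refl) (inj₁ refl) _    =
    record { left-edge = left-edge S ; right-edge = right-edge S
           ; left-quad = swap₃₄ (left-quad S) ; right-quad = swap₃₄ (right-quad S) }
  Split-choose S (inj₂ refl) (inj₂ refl) y≢y′ = contradiction refl y≢y′

  meetsInPair : Split a b c d u w → IsEdge H G → a ∈ G → b ∈ G → c ∉ G → d ∉ G → Quad G a b u w
  meetsInPair S G-edge a∈G b∈G c∉G d∉G =
    let (u∈G , w∈G) = avoids₁₂⇒∋₃₄ (right-edge S) (right-quad S) G-edge c∉G d∉G
    in Quad-move (left-quad S) (uniform _ G-edge) a∈G b∈G u∈G w∈G

  -- G meets the edge {a, b, u, w} in two vertices, which can only be a and x.
  fourthInPair : ∀ {x} → Split a b c d u w → IsEdge H G → Quad G a c d x → b ∉ G → x ∈ᵖ (u , w)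
  fourthInPair {a = a} {b} {c} {d} {u} {w} {G} {x = x} S G-edge qG b∉G =
    let (_ , y∈L , _ , y≡x) = sharedBesides {p = a} {P = _≡ x} (left-edge S) G-edge (∈₂ qL) b∉G cases
    in inPair (subst (_∈ left S) y≡x y∈L)
    where
    qL = left-quad S
    qR = right-quad S
    cases : ∀ {y} → y ∈ left S → y ∈ G → y ≡ a ⊎ y ≡ x
    cases y∈L y∈G with Quad-cases qG y∈G
    ... | inj₁ y≡a                = inj₁ y≡a
    ... | inj₂ (inj₁ refl)        = contradiction y∈L (∉Quad qL (≢₁₂ qG ∘ sym) (∈∉⇒≢ y∈G b∉G) (≢₁₃ qR) (≢₁₄ qR))
    ... | inj₂ (inj₂ (inj₁ refl)) = contradiction y∈L (∉Quad qL (≢₁₃ qG ∘ sym) (∈∉⇒≢ y∈G b∉G) (≢₂₃ qR) (≢₂₄ qR))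
    ... | inj₂ (inj₂ (inj₂ y≡x))  = inj₂ y≡x
    inPair : x ∈ left S → x ∈ᵖ (u , w)
    inPair x∈L with Quad-cases qL x∈L
    ... | inj₁ refl        = contradiction refl (≢₁₄ qG)
    ... | inj₂ (inj₁ refl) = contradiction (∈₄ qG) b∉G
    ... | inj₂ (inj₂ x∈uw) = x∈uw

  -- The edges {a, b, u, w} and {a, c, u′, w′} share a second vertex besides a, which lies in both pairs.
  pairsMeet : ∀ {u′ w′} → b ≢ c → Split a b c d u w → Split a c b d u′ w′ →
              ∃ λ y → y ∈ᵖ (u , w) × y ∈ᵖ (u′ , w′)
  pairsMeet {b = b} {c} {a} {u = u} {w} {u′ = u′} {w′} b≢c S S′ =
    let (y , _ , _ , y∈uw×u′w′) = sharedBesides {p = a} (left-edge S) (left-edge S′) (∈₂ qL) b∉L′ cases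
    in y , y∈uw×u′w′
    where
    qL = left-quad S
    qL′ = left-quad S′
    b∉L′ : b ∉ left S′
    b∉L′ = ∉Quad qL′ (≢₁₂ qL ∘ sym) b≢c (≢₁₃ (right-quad S′)) (≢₁₄ (right-quad S′))
    inL′ : ∀ {y} → y ∈ left S′ → y ≢ a → y ≢ c → y ∈ᵖ (u′ , w′)
    inL′ y∈ y≢a y≢c with Quad-cases qL′ y∈
    ... | inj₁ y≡a           = contradiction y≡a y≢a
    ... | inj₂ (inj₁ y≡c)    = contradiction y≡c y≢c
    ... | inj₂ (inj₂ y∈u′w′) = y∈u′w′
    cases : ∀ {y} → y ∈ left S → y ∈ left S′ → y ≡ a ⊎ y ∈ᵖ (u , w) × y ∈ᵖ (u′ , w′)
    cases y∈L y∈L′ with Quad-cases qL y∈L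
    ... | inj₁ y≡a                = inj₁ y≡a
    ... | inj₂ (inj₁ refl)        = contradiction y∈L′ b∉L′
    ... | inj₂ (inj₂ (inj₁ refl)) = inj₂ (inj₁ refl , inL′ y∈L′ (≢₁₃ qL ∘ sym) (≢₁₃ (right-quad S) ∘ sym))
    ... | inj₂ (inj₂ (inj₂ refl)) = inj₂ (inj₂ refl , inL′ y∈L′ (≢₁₄ qL ∘ sym) (≢₁₄ (right-quad S) ∘ sym))

  record Splits : Set where
    constructor splits
    field
      {e}                 : Subset (Hypergraph.n H)
      {a₁ a₂ a₃ a₄}       : V
      {u₁ w₁ u₂ w₂ u₃ w₃} : V
      e-edge              : IsEdge H e
      q                   : Quad e a₁ a₂ a₃ a₄
      S₁                  : Split a₁ a₂ a₃ a₄ u₁ w₁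
      S₂                  : Split a₁ a₃ a₂ a₄ u₂ w₂
      S₃                  : Split a₁ a₄ a₂ a₃ u₃ w₃

  module Shapes (σ : Splits) where

    open Splits σ

    Hub : V → Set
    Hub x = x ∈ᵖ (u₁ , w₁) × x ∈ᵖ (u₂ , w₂) × x ∈ᵖ (u₃ , w₃)

    data Shape (G : Subset (Hypergraph.n H)) : Set where
      base      : Quad G a₁ a₂ a₃ a₄ → Shape G
      pair₁₂    : Quad G a₁ a₂ u₁ w₁ → Shape G
      pair₃₄    : Quad G a₃ a₄ u₁ w₁ → Shape G
      pair₁₃    : Quad G a₁ a₃ u₂ w₂ → Shape G
      pair₂₄    : Quad G a₂ a₄ u₂ w₂ → Shape G
      pair₁₄    : Quad G a₁ a₄ u₃ w₃ → Shape G
      pair₂₃    : Quad G a₂ a₃ u₃ w₃ → Shape G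
      triple₁₂₃ : ∀ {x} → Quad G a₁ a₂ a₃ x → Hub x → Shape G
      triple₁₂₄ : ∀ {x} → Quad G a₁ a₂ a₄ x → Hub x → Shape G
      triple₁₃₄ : ∀ {x} → Quad G a₁ a₃ a₄ x → Hub x → Shape G
      triple₂₃₄ : ∀ {x} → Quad G a₂ a₃ a₄ x → Hub x → Shape G

    shapeBy : IsEdge H G → Dec (a₁ ∈ G) → Dec (a₂ ∈ G) → Dec (a₃ ∈ G) → Dec (a₄ ∈ G) → Shape G
    shapeBy G-edge (yes in₁) (yes in₂) (yes in₃) (yes in₄) = base (Quad-move q (uniform _ G-edge) in₁ in₂ in₃ in₄)
    shapeBy G-edge (yes in₁) (yes in₂) (no out₃) (no out₄) = pair₁₂ (meetsInPair S₁ G-edge in₁ in₂ out₃ out₄)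
    shapeBy G-edge (no out₁) (no out₂) (yes in₃) (yes in₄) = pair₃₄ (meetsInPair (Split-flip S₁) G-edge in₃ in₄ out₁ out₂)
    shapeBy G-edge (yes in₁) (no out₂) (yes in₃) (no out₄) = pair₁₃ (meetsInPair S₂ G-edge in₁ in₃ out₂ out₄)
    shapeBy G-edge (no out₁) (yes in₂) (no out₃) (yes in₄) = pair₂₄ (meetsInPair (Split-flip S₂) G-edge in₂ in₄ out₁ out₃)
    shapeBy G-edge (yes in₁) (no out₂) (no out₃) (yes in₄) = pair₁₄ (meetsInPair S₃ G-edge in₁ in₄ out₂ out₃)
    shapeBy G-edge (no out₁) (yes in₂) (yes in₃) (no out₄) = pair₂₃ (meetsInPair (Split-flip S₃) G-edge in₂ in₃ out₁ out₄)
    shapeBy G-edge (yes in₁) (yes in₂) (yes in₃) (no out₄) =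
      let (x , qG) = completeQuad (uniform _ G-edge) in₁ in₂ in₃ (≢₁₂ q) (≢₁₃ q) (≢₂₃ q)
      in triple₁₂₃ qG ( fourthInPair (Split-flip S₁) G-edge (swap₁₂ (swap₂₃ qG)) out₄
                      , fourthInPair (Split-flip S₂) G-edge (swap₁₂ qG) out₄
                      , fourthInPair S₃ G-edge qG out₄)
    shapeBy G-edge (yes in₁) (yes in₂) (no out₃) (yes in₄) =
      let (x , qG) = completeQuad (uniform _ G-edge) in₁ in₂ in₄ (≢₁₂ q) (≢₁₄ q) (≢₂₄ q)
      in triple₁₂₄ qG ( fourthInPair (Split-swapˡ (Split-flip S₁)) G-edge (swap₁₂ (swap₂₃ qG)) out₃
                      , fourthInPair S₂ G-edge qG out₃
                      , fourthInPair (Split-flip S₃) G-edge (swap₁₂ qG) out₃)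
    shapeBy G-edge (yes in₁) (no out₂) (yes in₃) (yes in₄) =
      let (x , qG) = completeQuad (uniform _ G-edge) in₁ in₃ in₄ (≢₁₃ q) (≢₁₄ q) (≢₃₄ q)
      in triple₁₃₄ qG ( fourthInPair S₁ G-edge qG out₂
                      , fourthInPair (Split-swapˡ (Split-flip S₂)) G-edge (swap₁₂ (swap₂₃ qG)) out₂
                      , fourthInPair (Split-swapˡ (Split-flip S₃)) G-edge (swap₁₂ qG) out₂)
    shapeBy G-edge (no out₁) (yes in₂) (yes in₃) (yes in₄) =
      let (x , qG) = completeQuad (uniform _ G-edge) in₂ in₃ in₄ (≢₂₃ q) (≢₂₄ q) (≢₃₄ q)
      in triple₂₃₄ qG ( fourthInPair (Split-swapˡ S₁) G-edge qG out₁
                      , fourthInPair (Split-swapˡ S₂) G-edge (swap₁₂ qG) out₁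
                      , fourthInPair (Split-swapˡ S₃) G-edge (swap₁₂ (swap₂₃ qG)) out₁)
    shapeBy G-edge (yes _)   (no out₂) (no out₃) (no out₄) = ⊥-elim (¬avoids₂₃₄ e-edge q G-edge out₂ out₃ out₄)
    shapeBy G-edge (no out₁) (yes _)   (no out₃) (no out₄) = ⊥-elim (¬avoids₂₃₄ e-edge (swap₁₂ q) G-edge out₁ out₃ out₄)
    shapeBy G-edge (no out₁) (no out₂) (yes _)   (no out₄) = ⊥-elim (¬avoids₂₃₄ e-edge (swapPairs q) G-edge out₄ out₁ out₂)
    shapeBy G-edge (no out₁) (no out₂) (no out₃) (yes _)   = ⊥-elim (¬avoids₂₃₄ e-edge (swap₁₂ (swapPairs q)) G-edge out₃ out₁ out₂)
    shapeBy G-edge (no _)    (no out₂) (no out₃) (no out₄) = ⊥-elim (¬avoids₂₃₄ e-edge q G-edge out₂ out₃ out₄)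

    shape : IsEdge H G → Shape G
    shape {G = G} G-edge = shapeBy G-edge (a₁ ∈? G) (a₂ ∈? G) (a₃ ∈? G) (a₄ ∈? G)

    hub? : ∀ y → Dec (Hub y)
    hub? y = ((y ≟ᶠ u₁) ⊎-dec (y ≟ᶠ w₁)) ×-dec ((y ≟ᶠ u₂) ⊎-dec (y ≟ᶠ w₂)) ×-dec ((y ≟ᶠ u₃) ⊎-dec (y ≟ᶠ w₃))

  module _ {k} (f : Fin k → V) (inRange : ∀ {G y} → IsEdge H G → y ∈ G → ∃ λ i → f i ≡ y) where

    edge≡image : IsEdge H G → ∃ λ T → ∣ T ∣ ≡ 4 × G ≡ image f T
    edge≡image {G} G-edge =
      let (_ , _ , _ , _ , qG) = ∣p∣≡4⇒Quad {S = G} (uniform G G-edge)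
      in preimage qG (inRange G-edge (∈₁ qG)) (inRange G-edge (∈₂ qG))
                     (inRange G-edge (∈₃ qG)) (inRange G-edge (∈₄ qG))
      where
      preimage : ∀ {p q r s} → Quad G p q r s → ∃ (λ i → f i ≡ p) → ∃ (λ i → f i ≡ q) →
                 ∃ (λ i → f i ≡ r) → ∃ (λ i → f i ≡ s) → ∃ λ T → ∣ T ∣ ≡ 4 × G ≡ image f T
      preimage qG (i₁ , refl) (i₂ , refl) (i₃ , refl) (i₄ , refl) =
        fromList (i₁ ∷ i₂ ∷ i₃ ∷ i₄ ∷ []) , Quad⇒∣preimage∣≡4 f i₁ i₂ i₃ i₄ qG , Quad⇒≡image f i₁ i₂ i₃ i₄ qG

    avoiding⊆image : ∀ {T i j} → ∁ T ≡ fromList (i ∷ j ∷ []) → IsEdge H G → f i ∉ G → f j ∉ G → G ⊆ image f T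
    avoiding⊆image {G} {T} {i} {j} ∁T≡ij G-edge fi∉G fj∉G y∈G = preimage (inRange G-edge y∈G) y∈G
      where
      preimage : ∀ {y} → ∃ (λ l → f l ≡ y) → y ∈ G → y ∈ image f T
      preimage (l , refl) fl∈G with l ∈? T
      ... | yes l∈T = ∈image⁺ f T l∈T
      ... | no  l∉T with ∈fromList⁻ (i ∷ j ∷ []) (subst (l ∈_) ∁T≡ij (x∉p⇒x∈∁p l∉T))
      ...   | Any.here refl             = contradiction fl∈G fi∉G
      ...   | Any.there (Any.here refl) = contradiction fl∈G fj∉G

    -- ∁ T is a pair {i, j}; an edge avoiding f i and f j lies in image f T, which has at most four vertices.
    image-isEdge : (T : Subset k) → ∣ T ∣ ≡ 4 → ∣ ∁ T ∣ ≡ 2 → IsEdge H (image f T)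
    image-isEdge T ∣T∣≡4 ∣∁T∣≡2 =
      let (i , j , ∁T≡ij) = ∣p∣≡2⇒pair {S = ∁ T} ∣∁T∣≡2
          (G , G-edge , fi∉G , fj∉G) = edgeAvoiding (f i) (f j)
      in subst (IsEdge H)
           (p⊆q∧∣q∣≤∣p∣⇒p≡q (avoiding⊆image {T = T} ∁T≡ij G-edge fi∉G fj∉G)
                            (≤-trans (∣image∣≤4 f T ∣T∣≡4) (≤-reflexive (sym (uniform G G-edge)))))
           G-edge

  sixVertices⇒≅K₆⁴ : (f : Fin 6 → V) → Injective _≡_ _≡_ f →
                     (∀ {G y} → IsEdge H G → y ∈ G → ∃ λ i → f i ≡ y) → IsoIgnoringIsolated H K6-4
  sixVertices⇒≅K₆⁴ f f-inj inRange = record { f = f ; inj = f-inj ; fwd = fwd ; bwd = bwd }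
    where
    fwd : ∀ T → IsEdge K6-4 T → IsEdge H (image f T)
    fwd T T-edge = let ∣T∣≡4 = ⌊⌋≡true⇒ (∣ T ∣ ≟ℕ 4) T-edge in
      image-isEdge f inRange T ∣T∣≡4 (trans (∣∁p∣≡n∸∣p∣ T) (cong (6 ∸_) ∣T∣≡4))
    bwd : ∀ G → IsEdge H G → ∃ λ T → IsEdge K6-4 T × G ≡ image f T
    bwd G G-edge = let (T , ∣T∣≡4 , G≡fT) = edge≡image f inRange G-edge in
      T , ⌊⌋≡true⇐ (∣ T ∣ ≟ℕ 4) ∣T∣≡4 , G≡fT

  module CaseK₆⁴ (σ : Splits) {z : V} (z-hub : Shapes.Hub σ z) where

    open Splits σ
    open Shapes σ

    -- An edge avoiding a₁ and z can only be {a₂, a₃, a₄, z′} for a second hub z′.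
    secondHub : ∃ λ z′ → z ≢ z′ × Hub z′
    secondHub = let (G , G-edge , a₁∉G , z∉G) = edgeAvoiding a₁ z in fromShape a₁∉G z∉G (shape G-edge)
      where
      fromShape : a₁ ∉ G → z ∉ G → Shape G → ∃ λ z′ → z ≢ z′ × Hub z′
      fromShape a₁∉G _   (base qG)             = contradiction (∈₁ qG) a₁∉G
      fromShape a₁∉G _   (pair₁₂ qG)           = contradiction (∈₁ qG) a₁∉G
      fromShape _    z∉G (pair₃₄ qG)           = contradiction (∈ᵖ⇒∈ qG (proj₁ z-hub)) z∉G
      fromShape a₁∉G _   (pair₁₃ qG)           = contradiction (∈₁ qG) a₁∉G
      fromShape _    z∉G (pair₂₄ qG)           = contradiction (∈ᵖ⇒∈ qG (proj₁ (proj₂ z-hub))) z∉G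
      fromShape a₁∉G _   (pair₁₄ qG)           = contradiction (∈₁ qG) a₁∉G
      fromShape _    z∉G (pair₂₃ qG)           = contradiction (∈ᵖ⇒∈ qG (proj₂ (proj₂ z-hub))) z∉G
      fromShape a₁∉G _   (triple₁₂₃ qG _)      = contradiction (∈₁ qG) a₁∉G
      fromShape a₁∉G _   (triple₁₂₄ qG _)      = contradiction (∈₁ qG) a₁∉G
      fromShape a₁∉G _   (triple₁₃₄ qG _)      = contradiction (∈₁ qG) a₁∉G
      fromShape _    z∉G (triple₂₃₄ qG z′-hub) = _ , ∈∉⇒≢ (∈₄ qG) z∉G ∘ sym , z′-hub

    z′ : V
    z′ = proj₁ secondHub

    z≢z′ : z ≢ z′
    z≢z′ = proj₁ (proj₂ secondHub)

    z′-hub : Hub z′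
    z′-hub = proj₂ (proj₂ secondHub)

    S₁′ : Split a₁ a₂ a₃ a₄ z z′
    S₁′ = Split-choose S₁ (proj₁ z-hub) (proj₁ z′-hub) z≢z′

    S₂′ : Split a₁ a₃ a₂ a₄ z z′
    S₂′ = Split-choose S₂ (proj₁ (proj₂ z-hub)) (proj₁ (proj₂ z′-hub)) z≢z′

    S₃′ : Split a₁ a₄ a₂ a₃ z z′
    S₃′ = Split-choose S₃ (proj₂ (proj₂ z-hub)) (proj₂ (proj₂ z′-hub)) z≢z′

    vertices : Vec V 6
    vertices = a₁ ∷ a₂ ∷ a₃ ∷ a₄ ∷ z ∷ z′ ∷ []

    vertices-unique : Vec.Unique vertices
    vertices-unique =
      (≢₁₂ q ∷ ≢₁₃ q ∷ ≢₁₄ q ∷ ≢₁₃ L₁ ∷ ≢₁₄ L₁ ∷ []) ∷ (≢₂₃ q ∷ ≢₂₄ q ∷ ≢₂₃ L₁ ∷ ≢₂₄ L₁ ∷ []) ∷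
      (≢₃₄ q ∷ ≢₁₃ R₁ ∷ ≢₁₄ R₁ ∷ []) ∷ (≢₂₃ R₁ ∷ ≢₂₄ R₁ ∷ []) ∷ (z≢z′ ∷ []) ∷ [] ∷ []
      where
      L₁ = left-quad S₁′
      R₁ = right-quad S₁′

    Listed : V → Set
    Listed y = ∃ λ i → lookup vertices i ≡ y

    module S′ = Shapes (splits e-edge q S₁′ S₂′ S₃′)

    everyVertexListed : ∀ {G y} → IsEdge H G → y ∈ G → Listed y
    everyVertexListed {G} G-edge = inShape (S′.shape G-edge)
      where
      l₁ : Listed a₁
      l₁ = # 0 , refl
      l₂ : Listed a₂
      l₂ = # 1 , refl
      l₃ : Listed a₃
      l₃ = # 2 , refl
      l₄ : Listed a₄
      l₄ = # 3 , refl
      lz : Listed z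
      lz = # 4 , refl
      lz′ : Listed z′
      lz′ = # 5 , refl
      hubListed : ∀ {y} → y ∈ᵖ (z , z′) → Listed y
      hubListed (inj₁ refl) = lz
      hubListed (inj₂ refl) = lz′
      inQuad : ∀ {p q r s y} → Quad G p q r s → Listed p → Listed q → Listed r → Listed s → y ∈ G → Listed y
      inQuad qG lp lq lr ls y∈G with Quad-cases qG y∈G
      ... | inj₁ refl               = lp
      ... | inj₂ (inj₁ refl)        = lq
      ... | inj₂ (inj₂ (inj₁ refl)) = lr
      ... | inj₂ (inj₂ (inj₂ refl)) = ls
      inShape : S′.Shape G → ∀ {y} → y ∈ G → Listed y
      inShape (S′.base qG)              = inQuad qG l₁ l₂ l₃ l₄
      inShape (S′.pair₁₂ qG)            = inQuad qG l₁ l₂ lz lz′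
      inShape (S′.pair₃₄ qG)            = inQuad qG l₃ l₄ lz lz′
      inShape (S′.pair₁₃ qG)            = inQuad qG l₁ l₃ lz lz′
      inShape (S′.pair₂₄ qG)            = inQuad qG l₂ l₄ lz lz′
      inShape (S′.pair₁₄ qG)            = inQuad qG l₁ l₄ lz lz′
      inShape (S′.pair₂₃ qG)            = inQuad qG l₂ l₃ lz lz′
      inShape (S′.triple₁₂₃ qG y-hub)   = inQuad qG l₁ l₂ l₃ (hubListed (proj₁ y-hub))
      inShape (S′.triple₁₂₄ qG y-hub)   = inQuad qG l₁ l₂ l₄ (hubListed (proj₁ y-hub))
      inShape (S′.triple₁₃₄ qG y-hub)   = inQuad qG l₁ l₃ l₄ (hubListed (proj₁ y-hub))
      inShape (S′.triple₂₃₄ qG y-hub)   = inQuad qG l₂ l₃ l₄ (hubListed (proj₁ y-hub))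

    iso : IsoIgnoringIsolated H K6-4
    iso = sixVertices⇒≅K₆⁴ (lookup vertices) (λ {i} {j} → lookup-injective vertices-unique i j) everyVertexListed

  module CaseFano (σ : Splits) (noHub : ∀ {y} → ¬ Shapes.Hub σ y) where

    open Splits σ

    m₁₂ : ∃ λ y → y ∈ᵖ (u₁ , w₁) × y ∈ᵖ (u₂ , w₂)
    m₁₂ = pairsMeet (≢₂₃ q) S₁ S₂

    m₁₃ : ∃ λ y → y ∈ᵖ (u₁ , w₁) × y ∈ᵖ (u₃ , w₃)
    m₁₃ = pairsMeet (≢₂₄ q) (Split-swapʳ S₁) S₃

    m₂₃ : ∃ λ y → y ∈ᵖ (u₂ , w₂) × y ∈ᵖ (u₃ , w₃)
    m₂₃ = pairsMeet (≢₃₄ q) (Split-swapʳ S₂) (Split-swapʳ S₃)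

    p₁₂ p₁₃ p₂₃ : V
    p₁₂ = proj₁ m₁₂
    p₁₃ = proj₁ m₁₃
    p₂₃ = proj₁ m₂₃

    p₁₂∈₁ : p₁₂ ∈ᵖ (u₁ , w₁)
    p₁₂∈₁ = proj₁ (proj₂ m₁₂)
    p₁₂∈₂ : p₁₂ ∈ᵖ (u₂ , w₂)
    p₁₂∈₂ = proj₂ (proj₂ m₁₂)
    p₁₃∈₁ : p₁₃ ∈ᵖ (u₁ , w₁)
    p₁₃∈₁ = proj₁ (proj₂ m₁₃)
    p₁₃∈₃ : p₁₃ ∈ᵖ (u₃ , w₃)
    p₁₃∈₃ = proj₂ (proj₂ m₁₃)
    p₂₃∈₂ : p₂₃ ∈ᵖ (u₂ , w₂)
    p₂₃∈₂ = proj₁ (proj₂ m₂₃)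
    p₂₃∈₃ : p₂₃ ∈ᵖ (u₃ , w₃)
    p₂₃∈₃ = proj₂ (proj₂ m₂₃)

    p₁₂≢p₁₃ : p₁₂ ≢ p₁₃
    p₁₂≢p₁₃ eq = noHub (p₁₂∈₁ , p₁₂∈₂ , subst (_∈ᵖ (u₃ , w₃)) (sym eq) p₁₃∈₃)

    p₁₂≢p₂₃ : p₁₂ ≢ p₂₃
    p₁₂≢p₂₃ eq = noHub (p₁₂∈₁ , p₁₂∈₂ , subst (_∈ᵖ (u₃ , w₃)) (sym eq) p₂₃∈₃)

    p₁₃≢p₂₃ : p₁₃ ≢ p₂₃
    p₁₃≢p₂₃ eq = noHub (p₁₃∈₁ , subst (_∈ᵖ (u₂ , w₂)) (sym eq) p₂₃∈₂ , p₁₃∈₃)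

    S₁′ : Split a₁ a₂ a₃ a₄ p₁₂ p₁₃
    S₁′ = Split-choose S₁ p₁₂∈₁ p₁₃∈₁ p₁₂≢p₁₃

    S₂′ : Split a₁ a₃ a₂ a₄ p₁₂ p₂₃
    S₂′ = Split-choose S₂ p₁₂∈₂ p₂₃∈₂ p₁₂≢p₂₃

    S₃′ : Split a₁ a₄ a₂ a₃ p₁₃ p₂₃
    S₃′ = Split-choose S₃ p₁₃∈₃ p₂₃∈₃ p₁₃≢p₂₃

    module S′ = Shapes (splits e-edge q S₁′ S₂′ S₃′)

    noHub′ : ∀ {y} → ¬ S′.Hub y
    noHub′ (y∈₁ , y∈₂ , y∈₃) =
      noHub (∈ᵖ-sub y∈₁ p₁₂∈₁ p₁₃∈₁ , ∈ᵖ-sub y∈₂ p₁₂∈₂ p₂₃∈₂ , ∈ᵖ-sub y∈₃ p₁₃∈₃ p₂₃∈₃)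

    -- Numbered as the points 1, …, 7 of the Fano plane.
    vertices : Vec V 7
    vertices = a₁ ∷ a₂ ∷ a₃ ∷ p₂₃ ∷ p₁₂ ∷ a₄ ∷ p₁₃ ∷ []

    vertices-unique : Vec.Unique vertices
    vertices-unique =
      (≢₁₂ q ∷ ≢₁₃ q ∷ ≢₁₄ L₂ ∷ ≢₁₃ L₁ ∷ ≢₁₄ q ∷ ≢₁₄ L₁ ∷ []) ∷
      (≢₂₃ q ∷ ≢₁₄ R₂ ∷ ≢₂₃ L₁ ∷ ≢₂₄ q ∷ ≢₂₄ L₁ ∷ []) ∷
      (≢₂₄ L₂ ∷ ≢₁₃ R₁ ∷ ≢₃₄ q ∷ ≢₁₄ R₁ ∷ []) ∷
      (≢₃₄ L₂ ∘ sym ∷ ≢₂₄ R₂ ∘ sym ∷ ≢₃₄ L₃ ∘ sym ∷ []) ∷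
      (≢₂₃ R₁ ∘ sym ∷ ≢₃₄ L₁ ∷ []) ∷
      (≢₂₄ R₁ ∷ []) ∷ [] ∷ []
      where
      L₁ = left-quad S₁′
      R₁ = right-quad S₁′
      L₂ = left-quad S₂′
      R₂ = right-quad S₂′
      L₃ = left-quad S₃′

    f : Fin 7 → V
    f = lookup vertices

    quad⇒image-isEdge : ∀ {G} (i₁ i₂ i₃ i₄ : Fin 7) → IsEdge H G → Quad G (f i₁) (f i₂) (f i₃) (f i₄) →
                        IsEdge H (image f (fromList (i₁ ∷ i₂ ∷ i₃ ∷ i₄ ∷ [])))
    quad⇒image-isEdge i₁ i₂ i₃ i₄ G-edge qG = subst (IsEdge H) (Quad⇒≡image f i₁ i₂ i₃ i₄ qG) G-edge

    fwd : ∀ T → IsEdge FanoComplement T → IsEdge H (image f T)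
    fwd T T-edge = fromLine (fano-edge⁻ {T} T-edge)
      where
      fromLine : ∀ {T} → Any (λ L → T ≡ ∁ L) fanoLines → IsEdge H (image f T)
      fromLine (Any.here refl) =
        quad⇒image-isEdge (# 2) (# 5) (# 4) (# 6) (right-edge S₁′) (right-quad S₁′)
      fromLine (Any.there (Any.here refl)) =
        quad⇒image-isEdge (# 0) (# 5) (# 6) (# 3) (left-edge S₃′) (left-quad S₃′)
      fromLine (Any.there (Any.there (Any.here refl))) =
        quad⇒image-isEdge (# 0) (# 1) (# 4) (# 6) (left-edge S₁′) (left-quad S₁′)
      fromLine (Any.there (Any.there (Any.there (Any.here refl)))) =
        quad⇒image-isEdge (# 0) (# 1) (# 2) (# 5) e-edge q
      fromLine (Any.there (Any.there (Any.there (Any.there (Any.here refl))))) =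
        quad⇒image-isEdge (# 1) (# 2) (# 6) (# 3) (right-edge S₃′) (right-quad S₃′)
      fromLine (Any.there (Any.there (Any.there (Any.there (Any.there (Any.here refl)))))) =
        quad⇒image-isEdge (# 0) (# 2) (# 4) (# 3) (left-edge S₂′) (left-quad S₂′)
      fromLine (Any.there (Any.there (Any.there (Any.there (Any.there (Any.there (Any.here refl))))))) =
        quad⇒image-isEdge (# 1) (# 5) (# 4) (# 3) (right-edge S₂′) (right-quad S₂′)

    bwd : ∀ G → IsEdge H G → ∃ λ T → IsEdge FanoComplement T × G ≡ image f T
    bwd G G-edge = fromShape (S′.shape G-edge)
      where
      fromShape : S′.Shape G → ∃ λ T → IsEdge FanoComplement T × G ≡ image f T
      fromShape (S′.base qG)   = ∁ (triple 4 5 7) , refl , Quad⇒≡image f (# 0) (# 1) (# 2) (# 5) qG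
      fromShape (S′.pair₁₂ qG) = ∁ (triple 3 4 6) , refl , Quad⇒≡image f (# 0) (# 1) (# 4) (# 6) qG
      fromShape (S′.pair₃₄ qG) = ∁ (triple 1 2 4) , refl , Quad⇒≡image f (# 2) (# 5) (# 4) (# 6) qG
      fromShape (S′.pair₁₃ qG) = ∁ (triple 6 7 2) , refl , Quad⇒≡image f (# 0) (# 2) (# 4) (# 3) qG
      fromShape (S′.pair₂₄ qG) = ∁ (triple 7 1 3) , refl , Quad⇒≡image f (# 1) (# 5) (# 4) (# 3) qG
      fromShape (S′.pair₁₄ qG) = ∁ (triple 2 3 5) , refl , Quad⇒≡image f (# 0) (# 5) (# 6) (# 3) qG
      fromShape (S′.pair₂₃ qG) = ∁ (triple 5 6 1) , refl , Quad⇒≡image f (# 1) (# 2) (# 6) (# 3) qG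
      fromShape (S′.triple₁₂₃ _ y-hub) = ⊥-elim (noHub′ y-hub)
      fromShape (S′.triple₁₂₄ _ y-hub) = ⊥-elim (noHub′ y-hub)
      fromShape (S′.triple₁₃₄ _ y-hub) = ⊥-elim (noHub′ y-hub)
      fromShape (S′.triple₂₃₄ _ y-hub) = ⊥-elim (noHub′ y-hub)

    iso : IsoIgnoringIsolated H FanoComplement
    iso = record { f = f ; inj = λ {i} {j} → lookup-injective vertices-unique i j ; fwd = fwd ; bwd = bwd }

  classify : IsoIgnoringIsolated H K6-4 ⊎ IsoIgnoringIsolated H FanoComplement
  classify =
    let (e , e-edge)        = someEdge
        (_ , _ , _ , _ , q) = ∣p∣≡4⇒Quad {S = e} (uniform e e-edge)
        (_ , _ , S₁)        = split e-edge q
        (_ , _ , S₂)        = split e-edge (swap₂₃ q)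
        (_ , _ , S₃)        = split e-edge (swap₂₃ (swap₃₄ q))
        σ                   = splits e-edge q S₁ S₂ S₃
    in byHub σ (Fin.any? (Shapes.hub? σ))
    where
    byHub : (σ : Splits) → Dec (∃ (Shapes.Hub σ)) → IsoIgnoringIsolated H K6-4 ⊎ IsoIgnoringIsolated H FanoComplement
    byHub σ (yes (_ , z-hub)) = inj₁ (CaseK₆⁴.iso σ z-hub)
    byHub σ (no  ¬hub)        = inj₂ (CaseFano.iso σ (λ hub → ¬hub (_ , hub)))

-- Properties of K₆⁴ and of the Fano complement

allSubset? : {P : Subset m → Set} → (∀ S → Dec (P S)) → Dec (∀ S → P S)
allSubset? P? with anySubset? (¬? ∘ P?)
... | yes (S , ¬PS) = no λ all → ¬PS (all S)
... | no  ¬∃¬P      = yes λ S → decidable-stable (P? S) (λ ¬PS → ¬∃¬P (S , ¬PS))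

cover? : (H : Hypergraph) → (C : Subset (Hypergraph.n H)) → Dec (Cover H C)
cover? H C = allSubset? λ e → (Edge H e ≟ᵇ true) →-dec nonempty? (C ∩ e)

K₆⁴-uniform : Uniform 4 K6-4
K₆⁴-uniform T T-edge = ⌊⌋≡true⇒ (∣ T ∣ ≟ℕ 4) T-edge

K₆⁴-intersecting : TwoIntersecting K6-4
K₆⁴-intersecting = toWitness {a? = allSubset? λ e → allSubset? λ f →
  (Edge K6-4 e ≟ᵇ true) →-dec (Edge K6-4 f ≟ᵇ true) →-dec ¬? (e ≟ₛ f) →-dec 2 ≤? ∣ e ∩ f ∣} tt

K₆⁴-τ≡3 : CoveringNumber K6-4 3
K₆⁴-τ≡3 = (C , toWitness {a? = cover? K6-4 C} tt , refl)
        , toWitness {a? = allSubset? λ C → cover? K6-4 C →-dec 3 ≤? ∣ C ∣} tt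
  where
  C = fromList (# 0 ∷ # 1 ∷ # 2 ∷ [])

Fano-uniform : Uniform 4 FanoComplement
Fano-uniform = fano-all (toWitness {a? = All.all? (λ L → ∣ ∁ L ∣ ≟ℕ 4) fanoLines} tt)

Fano-intersecting : TwoIntersecting FanoComplement
Fano-intersecting e f e-edge f-edge = fano-all (fano-all pairwise e e-edge) f f-edge
  where
  pairwise : All (λ L → All (λ L′ → ∁ L ≢ ∁ L′ → 2 ≤ ∣ ∁ L ∩ ∁ L′ ∣) fanoLines) fanoLines
  pairwise = toWitness {a? = All.all? (λ L → All.all? (λ L′ →
    ¬? (∁ L ≟ₛ ∁ L′) →-dec 2 ≤? ∣ ∁ L ∩ ∁ L′ ∣) fanoLines) fanoLines} tt

Fano-τ≡3 : CoveringNumber FanoComplement 3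
Fano-τ≡3 = (C , fano-all (toWitness {a? = All.all? (λ L → nonempty? (C ∩ ∁ L)) fanoLines} tt) , refl)
         , λ C C-covers → meetsAllLines⇒3≤ C (All.tabulate λ L∈ → C-covers _ (fano-edge⁺ (Any.map (cong ∁) L∈)))
  where
  C = fromList (# 0 ∷ # 1 ∷ # 2 ∷ [])
  meetsAllLines⇒3≤ : ∀ C → All (λ L → Nonempty (C ∩ ∁ L)) fanoLines → 3 ≤ ∣ C ∣
  meetsAllLines⇒3≤ = toWitness {a? = allSubset? λ C →
    All.all? (λ L → nonempty? (C ∩ ∁ L)) fanoLines →-dec 3 ≤? ∣ C ∣} tt

Fano-noIsolated : ∀ y → ∃ λ T → IsEdge FanoComplement T × y ∈ T
Fano-noIsolated = toWitness {a? = Fin.all? λ y → anySubset? λ T → (Edge FanoComplement T ≟ᵇ true) ×-dec y ∈? T} tt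

iso⇒≤ : ∀ {H K} → IsoIgnoringIsolated H K → Hypergraph.n K ≤ Hypergraph.n H
iso⇒≤ iso = Fin.injective⇒≤ (IsoIgnoringIsolated.inj iso)

iso⇒≥ : ∀ {H K} → (∀ y → ∃ λ G → IsEdge H G × y ∈ G) → IsoIgnoringIsolated H K → Hypergraph.n H ≤ Hypergraph.n K
iso⇒≥ noIsolated iso = Fin.injective⇒≤ preimage-injective
  where
  open IsoIgnoringIsolated iso
  preimage : ∀ y → ∃ λ k → f k ≡ y
  preimage y =
    let (G , G-edge , y∈G) = noIsolated y
        (T , _ , G≡fT)     = bwd G G-edge
        (k , _ , fk≡y)     = ∈image⁻ f T (subst (y ∈_) G≡fT y∈G)
    in k , fk≡y
  preimage-injective : Injective _≡_ _≡_ (proj₁ ∘ preimage)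
  preimage-injective {y₁} {y₂} eq = trans (sym (proj₂ (preimage y₁))) (trans (cong f eq) (proj₂ (preimage y₂)))

K₆⁴≇Fano : ¬ IsoIgnoringIsolated K6-4 FanoComplement
K₆⁴≇Fano iso = <⇒≱ (n<1+n 6) (iso⇒≤ iso)

Fano≇K₆⁴ : ¬ IsoIgnoringIsolated FanoComplement K6-4
Fano≇K₆⁴ iso = <⇒≱ (n<1+n 6) (iso⇒≥ Fano-noIsolated iso)

mainTheorem14 : ((H : Hypergraph) → Uniform 4 H → TwoIntersecting H → CoveringNumber H 3
                   → IsoIgnoringIsolated H K6-4 ⊎ IsoIgnoringIsolated H FanoComplement)
                × (Uniform 4 K6-4 × TwoIntersecting K6-4 × CoveringNumber K6-4 3)
                × (Uniform 4 FanoComplement × TwoIntersecting FanoComplement × CoveringNumber FanoComplement 3)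
                × ¬ IsoIgnoringIsolated K6-4 FanoComplement
                × ¬ IsoIgnoringIsolated FanoComplement K6-4
mainTheorem14 =
    (λ H uniform intersecting τ≡3 → Classification.classify H uniform intersecting (proj₂ τ≡3))
  , (K₆⁴-uniform , K₆⁴-intersecting , K₆⁴-τ≡3)
  , (Fano-uniform , Fano-intersecting , Fano-τ≡3)
  , K₆⁴≇Fano
  , Fano≇K₆⁴
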